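{- Let $G=(X,Y,E)$, $\mathcal{P}_X$, $\mathcal{P}_Y$ be an instance of MIN-REP and let $G'$ be the graph constructed from it as described in the context. Then $G'$ is triangle-free.
   Context: MIN-REP instance: a bipartite graph $G=(X,Y,E)$, a partition $\mathcal{P}_X=\{X_1,\dots,X_{k_X}\}$ of $X$ into sets of size $|X|/k_X$, and a partition $\mathcal{P}_Y=\{Y_1,\dots,Y_{k_Y}\}$ of $Y$ into sets of size $|Y|/k_Y$. $X_i$ and $Y_j$ form a super edge if some vertex of $X_i$ is adjacent in $G$ to some vertex of $Y_j$. Construction of $G'$: start with $G$. For each $X_i$ add two vertices $px^1_i,px^2_i$ and edges $(x,px^1_i),(x,px^2_i)$ for every $x\in X_i$; for each $Y_j$ add two vertices $py^1_j,py^2_j$ and edges $(y,py^1_j),(y,py^2_j)$ for every $y\in Y_j$. For each super edge $(X_i,Y_j)$ add two vertices (relays) $r^1_{i,j},r^2_{i,j}$ and edges $(px^1_i,r^1_{i,j}),(r^1_{i,j},py^1_j),(px^2_i,r^2_{i,j}),(r^2_{i,j},py^2_j)$. Let $PX$ be the set of all $px^I_i$, $PY$ the set of all $py^I_j$, $R$ the set of relays. Add four hubs $h_{X,R},h_{Y,R},h_{PX},h_{PY}$: $h_{X,R}$ is adjacent to every vertex of $X\cup R$, $h_{Y,R}$ to every vertex of $Y\cup R$, $h_{PX}$ to every vertex of $PX$, $h_{PY}$ to every vertex of $PY$, and the hubs form the 4-cycle $(h_{PX},h_{Y,R},h_{PY},h_{X,R},h_{PX})$. Finally, for each hub $h$ add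 two new vertices (dummy nodes) $d_1,d_2$ and edges $(h,d_1),(h,d_2)$. -}

module Defs where

open import Data.Nat using (ℕ)
open import Data.Fin using (Fin)
open import Data.Product using (∃; ∃-syntax)
open import Data.Sum using (_⊎_)
open import Data.Empty using (⊥)

-- X is split into kX parts X_1..X_kX, each of size a
-- (= |X|/kX); a vertex of X is a pair (i , u) meaning "element u of part X_i".
-- Similarly Y is split into kY parts of size b.  The bipartite edge relation is
-- E i u j v  :  (element u of X_i) is adjacent to (element v of Y_j).
record MinRep : Set₁ where
  field
    kX a kY b : ℕ
    E : Fin kX → Fin a → Fin kY → Fin b → Set

module _ (M : MinRep) where
  open MinRep M

  SuperEdge : Fin kX → Fin kY → Set
  SuperEdge i j = ∃[ u ] ∃[ v ] E i u j v

  data Hub : Set where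
    hXR hYR hPX hPY : Hub

  -- vertices of G'; the index I : Fin 2 encodes the superscript 1/2.
  -- A relay r^I_{i,j} exists only for super edges (i , j).
  data V' : Set where
    vx    : Fin kX → Fin a → V'
    vy    : Fin kY → Fin b → V'
    px    : Fin 2 → Fin kX → V'
    py    : Fin 2 → Fin kY → V'
    relay : Fin 2 → (i : Fin kX) (j : Fin kY) → SuperEdge i j → V'
    hub   : Hub → V'
    dummy : Hub → Fin 2 → V'

  -- the edges of G', each listed once (in one orientation)
  data Arc : V' → V' → Set where
    g-edge : ∀ {i u j v} → E i u j v → Arc (vx i u) (vy j v)
    x-px   : ∀ {i u} I → Arc (vx i u) (px I i)
    y-py   : ∀ {j v} I → Arc (vy j v) (py I j)
    px-r   : ∀ {I i j} (s : SuperEdge i j) → Arc (px I i) (relay I i j s)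
    r-py   : ∀ {I i j} (s : SuperEdge i j) → Arc (relay I i j s) (py I j)
    hXR-x  : ∀ {i u} → Arc (hub hXR) (vx i u)
    hXR-r  : ∀ {I i j} (s : SuperEdge i j) → Arc (hub hXR) (relay I i j s)
    hYR-y  : ∀ {j v} → Arc (hub hYR) (vy j v)
    hYR-r  : ∀ {I i j} (s : SuperEdge i j) → Arc (hub hYR) (relay I i j s)
    hPX-px : ∀ {I i} → Arc (hub hPX) (px I i)
    hPY-py : ∀ {I j} → Arc (hub hPY) (py I j)
    c1     : Arc (hub hPX) (hub hYR)
    c2     : Arc (hub hYR) (hub hPY)
    c3     : Arc (hub hPY) (hub hXR)
    c4     : Arc (hub hXR) (hub hPX)
    h-d    : ∀ {h} d → Arc (hub h) (dummy h d)

  Adj : V' → V' → Set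
  Adj p q = Arc p q ⊎ Arc q p

  -- G' contains no triangle (three pairwise adjacent vertices; adjacency is
  -- irreflexive, so such vertices are automatically distinct)
  TriangleFree : Set
  TriangleFree = ∀ p q r → Adj p q → Adj q r → Adj p r → ⊥

module Submission where

-- G' is triangle-free because it admits a graph homomorphism onto the
-- pentagon C₅, and C₅ has no triangle.
--
-- G' is not bipartite (x – y – py – r – px – x is a 5-cycle for every edge
-- (x , y) of G), so a 2-colouring cannot work; but a 5-colouring by the
-- vertices of C₅, in which adjacent vertices receive neighbouring colours,
-- does.

open import Defs
open import Data.Fin using (Fin; zero; suc; _≟_)
open import Data.Fin.Properties using (all?)
open import Data.Product using (_×_; _,_)
open import Data.Sum using (_⊎_; inj₁; inj₂)
open import Data.Empty using (⊥)
open import Relation.Nullary using (¬_)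
open import Relation.Nullary.Decidable using (Dec; ¬?; _×-dec_; _⊎-dec_; toWitness)
open import Relation.Binary.PropositionalEquality using (_≡_; refl)

TriangleFreeRel : {V : Set} → (V → V → Set) → Set
TriangleFreeRel {V} A = ∀ (p q r : V) → A p q → A q r → A p r → ⊥

homomorphism-reflects-triangleFree :
  {V W : Set} {A : V → V → Set} {B : W → W → Set} (f : V → W) →
  (∀ {p q} → A p q → B (f p) (f q)) →
  TriangleFreeRel B → TriangleFreeRel A
homomorphism-reflects-triangleFree f hom freeB p q r pq qr pr =
  freeB (f p) (f q) (f r) (hom pq) (hom qr) (hom pr)

rotate : Fin 5 → Fin 5
rotate zero                            = suc zero
rotate (suc zero)                      = suc (suc zero)
rotate (suc (suc zero))                = suc (suc (suc zero))
rotate (suc (suc (suc zero)))          = suc (suc (suc (suc zero)))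
rotate (suc (suc (suc (suc zero))))    = zero

C₅ : Fin 5 → Fin 5 → Set
C₅ k l = l ≡ rotate k ⊎ k ≡ rotate l

C₅-sym : ∀ {k l} → C₅ k l → C₅ l k
C₅-sym (inj₁ e) = inj₂ e
C₅-sym (inj₂ e) = inj₁ e

C₅-triangleFree : TriangleFreeRel C₅
C₅-triangleFree p q r pq qr pr = noTriangle p q r (pq , qr , pr)
  where
  C₅? : ∀ k l → Dec (C₅ k l)
  C₅? k l = (l ≟ rotate k) ⊎-dec (k ≟ rotate l)

  noTriangle : ∀ p q r → ¬ (C₅ p q × C₅ q r × C₅ p r)
  noTriangle = toWitness {a? = all? λ p → all? λ q → all? λ r →
                                 ¬? (C₅? p q ×-dec (C₅? q r ×-dec C₅? p r))} _

module _ (M : MinRep) where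
  open MinRep M

  -- The colouring wraps the 5-cycle  x – y – py – r – px  around C₅
  -- (colours 0,1,2,3,4); each hub is placed next to the colours of its
  -- neighbours, and each dummy vertex just after its hub.
  hubColour : Hub M → Fin 5
  hubColour hXR = suc (suc (suc (suc zero)))
  hubColour hYR = suc (suc zero)
  hubColour hPX = suc (suc (suc zero))
  hubColour hPY = suc (suc (suc zero))

  colour : V' M → Fin 5
  colour (vx _ _)        = zero
  colour (vy _ _)        = suc zero
  colour (py _ _)        = suc (suc zero)
  colour (relay _ _ _ _) = suc (suc (suc zero))
  colour (px _ _)        = suc (suc (suc (suc zero)))
  colour (hub h)         = hubColour h
  colour (dummy h _)     = rotate (hubColour h)

  arc-homomorphism : ∀ {p q} → Arc M p q → C₅ (colour p) (colour q)
  arc-homomorphism (g-edge _)   = inj₁ refl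
  arc-homomorphism (x-px _)     = inj₂ refl
  arc-homomorphism (y-py _)     = inj₁ refl
  arc-homomorphism (px-r _)     = inj₂ refl
  arc-homomorphism (r-py _)     = inj₂ refl
  arc-homomorphism hXR-x        = inj₁ refl
  arc-homomorphism (hXR-r _)    = inj₂ refl
  arc-homomorphism hYR-y        = inj₂ refl
  arc-homomorphism (hYR-r _)    = inj₁ refl
  arc-homomorphism hPX-px       = inj₁ refl
  arc-homomorphism hPY-py       = inj₂ refl
  arc-homomorphism c1           = inj₂ refl
  arc-homomorphism c2           = inj₁ refl
  arc-homomorphism c3           = inj₁ refl
  arc-homomorphism c4           = inj₂ refl
  arc-homomorphism (h-d _)      = inj₁ refl

  adj-homomorphism : ∀ {p q} → Adj M p q → C₅ (colour p) (colour q)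
  adj-homomorphism (inj₁ pq) = arc-homomorphism pq
  adj-homomorphism (inj₂ qp) = C₅-sym (arc-homomorphism qp)

lemma3 : (M : MinRep) → TriangleFree M
lemma3 M = homomorphism-reflects-triangleFree (colour M) (adj-homomorphism M)
             C₅-triangleFree
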